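{- Let $p\geq 1$ be an integer and $(a_n)_{n\in\mathbb{Z}}$ a bi-infinite sequence of complex numbers (or indeterminates). With the collections of paths and weight polynomials defined in the context, for every $m\in\mathbb{Z}_{\geq 0}$ and $0\leq j\leq p$: \begin{align*} R_{[m(p+1)+j,j]} &=\sum_{i_{1}=-p}^{(m-1)p+j}\,\sum_{i_{2}=i_{1}-p}^{(m-2)p+j}\,\sum_{i_{3}=i_{2}-p}^{(m-3)p+j}\cdots\sum_{i_{m}=i_{m-1}-p}^{j}\,\prod_{k=1}^{m}a_{i_{k}},\\ S_{[m(p+1)+j,j]} &=\sum_{i_{1}=0}^{j}\,\sum_{i_{2}=0}^{i_{1}+p}\,\sum_{i_{3}=0}^{i_{2}+p}\cdots\sum_{i_{m}=0}^{i_{m-1}+p}\,\prod_{k=1}^{m}a_{i_{k}},\\ T_{[m(p+1)+j,j]} &=\sum_{i_{1}=-j-p}^{ -p}\,\sum_{i_{2}=i_{1}-p}^{ -p}\,\sum_{i_{3}=i_{2}-p}^{ -p}\cdots\sum_{i_{m}=i_{m-1}-p}^{ -p}\,\prod_{k=1}^{m}a_{i_{k}}, \end{align*} where each right-hand side is understood to be $1$ when $m=0$.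
   Context: Consider lattice paths with vertices in $\mathbb{Z}_{\geq0}\times\mathbb{Z}$, given as finite sequences of steps (consecutive steps sharing endpoints), where only two kinds of steps are allowed: upsteps $(n,m)\to(n+1,m+1)$, of weight $1$, and downsteps $(n,m)\to(n+1,m-p)$ (down by exactly $p$ units), of weight $a_{m-p}$. The length of a path is its number of steps; its weight $w(\gamma)$ is the product of the weights of its steps ($1$ for a path of length $0$). $\min(\gamma)$, $\max(\gamma)$ are the minimal and maximal heights of its vertices. For $n\geq0$ and $0\leq j\leq p$: $\mathcal{R}_{[n,j]}$ is the set of such paths of length $n$ from $(0,0)$ to $(n,j)$; $\mathcal{S}_{[n,j]}$ is the set of paths in $\mathcal{R}_{[n,j]}$ with $\min(\gamma)=0$; $\widehat{\mathcal{S}}_{[n,j]}$ is the set of such paths of length $n$ from $(0,-j)$ to $(n,0)$ with $\max(\gamma)=0$. Define $R_{[n,j]}=\sum_{\gamma\in\mathcal{R}_{[n,j]}}w(\gamma)$, $S_{[n,j]}=\sum_{\gamma\in\mathcal{S}_{[n,j]}}w(\gamma)$, $T_{[n,j]}=\sum_{\gamma\in\widehat{\mathcal{S}}_{[n,j]}}w(\gamma)$. -}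

module Defs where

open import Level using (Level)
open import Algebra.Bundles using (CommutativeRing)
open import Data.Bool using (Bool; true; false; if_then_else_)
open import Data.Nat using (ℕ; zero; suc)
open import Data.Integer as ℤ using (ℤ; +_; _⊓_; _⊔_)
open import Data.List using (List; []; _∷_; map; _++_)
open import Relation.Nullary.Decidable using (⌊_⌋)

-- A step of a lattice path: true = upstep (+1), false = downstep (-p).
Step : Set
Step = Bool

allSeqs : ℕ → List (List Step)
allSeqs zero = [] ∷ []
allSeqs (suc n) = map (true ∷_) (allSeqs n) ++ map (false ∷_) (allSeqs n)

intsFrom : ℤ → ℕ → List ℤ
intsFrom lo zero = []
intsFrom lo (suc k) = lo ∷ intsFrom (lo ℤ.+ ℤ.1ℤ) k

range : ℤ → ℤ → List ℤ
range lo hi = if ⌊ lo ℤ.≤? hi ⌋ then intsFrom lo ℤ.∣ (hi ℤ.+ ℤ.1ℤ) ℤ.- lo ∣ else []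

module Paths (p : ℕ) where

  next : ℤ → Step → ℤ
  next h true  = h ℤ.+ ℤ.1ℤ
  next h false = h ℤ.- (+ p)

  endH : ℤ → List Step → ℤ
  endH h [] = h
  endH h (s ∷ ss) = endH (next h s) ss

  pathMin : ℤ → List Step → ℤ
  pathMin h [] = h
  pathMin h (s ∷ ss) = h ⊓ pathMin (next h s) ss

  pathMax : ℤ → List Step → ℤ
  pathMax h [] = h
  pathMax h (s ∷ ss) = h ⊔ pathMax (next h s) ss

module Weights {c ℓ : Level} (R : CommutativeRing c ℓ) (p : ℕ) (a : ℤ → CommutativeRing.Carrier R) where
  open CommutativeRing R
  open Paths p public

  weight : ℤ → List Step → Carrier
  weight h [] = 1#
  weight h (true ∷ ss) = weight (next h true) ss
  weight h (false ∷ ss) = a (next h false) * weight (next h false) ss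

  sumL : {A : Set} → (A → Carrier) → List A → Carrier
  sumL f [] = 0#
  sumL f (x ∷ xs) = f x + sumL f xs

  sumPaths : ℕ → ℤ → (List Step → Bool) → Carrier
  sumPaths n h P = sumL (λ γ → if P γ then weight h γ else 0#) (allSeqs n)

  Rpoly : ℕ → ℕ → Carrier
  Rpoly n j = sumPaths n (+ 0) (λ γ → ⌊ endH (+ 0) γ ℤ.≟ + j ⌋)

  Spoly : ℕ → ℕ → Carrier
  Spoly n j = sumPaths n (+ 0)
    (λ γ → ⌊ endH (+ 0) γ ℤ.≟ + j ⌋ Data.Bool.∧ ⌊ pathMin (+ 0) γ ℤ.≟ + 0 ⌋)

  Tpoly : ℕ → ℕ → Carrier
  Tpoly n j = sumPaths n (ℤ.- (+ j))
    (λ γ → ⌊ endH (ℤ.- (+ j)) γ ℤ.≟ + 0 ⌋ Data.Bool.∧ ⌊ pathMax (ℤ.- (+ j)) γ ℤ.≟ + 0 ⌋)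

  -- With r indices remaining (so the
  -- current index is i_k with k = m - r + 1):
  -- R: i_k ranges over [i_{k-1} - p , (m-k)p + j] = [prev - p , (r-1)p + j], i_0 := 0.
  nestedR : ℕ → ℕ → ℤ → Carrier
  nestedR j zero prev = 1#
  nestedR j (suc r) prev =
    sumL (λ i → a i * nestedR j r i) (range (prev ℤ.- + p) (+ (r Data.Nat.* p Data.Nat.+ j)))

  -- S: i_1 ∈ [0, j], i_k ∈ [0, i_{k-1} + p]; argument = current upper bound.
  nestedS : ℕ → ℤ → Carrier
  nestedS zero ub = 1#
  nestedS (suc r) ub = sumL (λ i → a i * nestedS r (i ℤ.+ + p)) (range (+ 0) ub)

  -- T: i_1 ∈ [-j-p, -p], i_k ∈ [i_{k-1} - p, -p]; argument = current lower bound.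
  nestedT : ℕ → ℤ → Carrier
  nestedT zero lo = 1#
  nestedT (suc r) lo = sumL (λ i → a i * nestedT r (i ℤ.- + p)) (range lo (ℤ.- + p))

  Rrhs : ℕ → ℕ → Carrier
  Rrhs m j = nestedR j m (+ 0)

  Srhs : ℕ → ℕ → Carrier
  Srhs m j = nestedS m (+ j)

  Trhs : ℕ → ℕ → Carrier
  Trhs m j = nestedT m (ℤ.- (+ j) ℤ.- + p)

-- Sorting paths by their first step gives, for the weighted sum P_n(h) over paths of
-- length n starting at height h, the recursion P_{n+1}(h) = P_n(h+1) + a_{h-p} P_n(h-p).
-- Splitting off the smallest value i₁ = h - p of the outermost range shows that the nested
-- sum for R satisfies the same recursion, and the boundary cases agree because a path of
-- length n from h can only end in [h - pn, h + n]; induction on the numbers of downsteps and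
-- upsteps then gives R.  The same argument gives T, since the constraint max ≤ 0 is inherited
-- by both successors of a height h ≤ 0.  The nested sum for S is indexed from the end of the
-- path, so there one sorts paths by their last step instead: a final downstep ends at the
-- current height t and contributes a_t, and splitting off the largest value t of the
-- outermost range gives the matching recursion.
module Submission where

open import Defs
open import Level using (Level)
open import Algebra.Bundles using (CommutativeRing)
open import Data.Nat using (ℕ; _+_; _*_; _≤_)
open import Data.Integer using (ℤ)
open import Data.Product using (_×_)

open import Data.Bool using (Bool; true; false; _∧_; if_then_else_)
open import Data.Empty using (⊥-elim)
open import Data.Integer as ℤ using (+_; 0ℤ; 1ℤ; _⊓_)
open import Data.Integer.Tactic.RingSolver using (solve-∀)
import Data.Integer.Properties as ℤₚ
open import Data.List using (List; []; _∷_; _++_; [_]; _∷ʳ_; length; map)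
open import Data.Nat as ℕ using (zero; suc)
import Data.Nat.Properties as ℕₚ
open import Data.Nat.Tactic.RingSolver using () renaming (solve-∀ to ℕ-solve-∀)
open import Data.Product using (_,_; proj₁; proj₂; map₂)
open import Function using (_∘_)
import Algebra.Properties.CommutativeSemigroup as CommutativeSemigroupProperties
import Relation.Binary.Reasoning.Setoid as ≈-Reasoning
open import Relation.Nullary using (Dec; yes; no; ¬_)
open import Relation.Nullary.Decidable using (⌊_⌋; _×-dec_)
open import Relation.Binary.PropositionalEquality using (_≡_; _≢_; refl; sym; trans; cong; subst; subst₂)

⌊⌋-cong : ∀ {A B : Set} (a? : Dec A) (b? : Dec B) → (A → B) → (B → A) → ⌊ a? ⌋ ≡ ⌊ b? ⌋
⌊⌋-cong (yes _) (yes _) _ _ = refl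
⌊⌋-cong (yes a) (no ¬b) f _ = ⊥-elim (¬b (f a))
⌊⌋-cong (no ¬a) (yes b) _ g = ⊥-elim (¬a (g b))
⌊⌋-cong (no _)  (no _)  _ _ = refl

⌊⌋-true : ∀ {A : Set} (a? : Dec A) → A → ⌊ a? ⌋ ≡ true
⌊⌋-true (yes _) _ = refl
⌊⌋-true (no ¬a) a = ⊥-elim (¬a a)

⌊⌋-false : ∀ {A : Set} (a? : Dec A) → ¬ A → ⌊ a? ⌋ ≡ false
⌊⌋-false (yes a) ¬a = ⊥-elim (¬a a)
⌊⌋-false (no _)  _  = refl

⌊⌋-true⁻¹ : ∀ {A : Set} (a? : Dec A) → ⌊ a? ⌋ ≡ true → A
⌊⌋-true⁻¹ (yes a) _ = a

⌊⌋-∧ : ∀ {A B : Set} (a? : Dec A) (b? : Dec B) → ⌊ a? ⌋ ∧ ⌊ b? ⌋ ≡ ⌊ a? ×-dec b? ⌋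
⌊⌋-∧ (yes _) (yes _) = refl
⌊⌋-∧ (yes _) (no _)  = refl
⌊⌋-∧ (no _)  _       = refl

i<i+[1+n] : ∀ i n → i ℤ.< i ℤ.+ + suc n
i<i+[1+n] i n = ℤₚ.suc[i]≤j⇒i<j (subst (ℤ.suc i ℤ.≤_) (shift i (+ n)) (ℤₚ.i≤i+j (ℤ.suc i) (+ n)))
  where
  shift : ∀ i n → (1ℤ ℤ.+ i) ℤ.+ n ≡ i ℤ.+ (1ℤ ℤ.+ n)
  shift = solve-∀

i-j+1≡i+1-j : ∀ i j → i ℤ.- j ℤ.+ 1ℤ ≡ i ℤ.+ 1ℤ ℤ.- j
i-j+1≡i+1-j = solve-∀

i+1+j≡i+[1+j] : ∀ i j → i ℤ.+ 1ℤ ℤ.+ j ≡ i ℤ.+ (1ℤ ℤ.+ j)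
i+1+j≡i+[1+j] = solve-∀

i-k+j<i+[1+j] : ∀ i k j → i ℤ.- + k ℤ.+ + j ℤ.< i ℤ.+ + suc j
i-k+j<i+[1+j] i k j = subst (i ℤ.- + k ℤ.+ + j ℤ.<_) (shift i (+ k) (+ j)) (i<i+[1+n] (i ℤ.- + k ℤ.+ + j) k)
  where
  shift : ∀ i k j → i ℤ.- k ℤ.+ j ℤ.+ (1ℤ ℤ.+ k) ≡ i ℤ.+ (1ℤ ℤ.+ j)
  shift = solve-∀

i+j≡k+l⇒i-k+j≡l : ∀ i j k l → i ℤ.+ j ≡ k ℤ.+ l → i ℤ.- k ℤ.+ j ≡ l
i+j≡k+l⇒i-k+j≡l i j k l eq = trans (lhs i j k) (trans (cong (ℤ._- k) eq) (rhs k l))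
  where
  lhs : ∀ i j k → i ℤ.- k ℤ.+ j ≡ i ℤ.+ j ℤ.- k
  lhs = solve-∀
  rhs : ∀ k l → k ℤ.+ l ℤ.- k ≡ l
  rhs = solve-∀

i-k+[j+k]≡i+j : ∀ i k j → i ℤ.- k ℤ.+ (j ℤ.+ k) ≡ i ℤ.+ j
i-k+[j+k]≡i+j = solve-∀

i+j-j≡i : ∀ i j → i ℤ.+ j ℤ.- j ≡ i
i+j-j≡i = solve-∀

+-cancelʳ-≡ : ∀ {i j} k → i ℤ.+ k ≡ j ℤ.+ k → i ≡ j
+-cancelʳ-≡ {i} {j} k eq = trans (sym (i+j-j≡i i k)) (trans (cong (ℤ._- k) eq) (i+j-j≡i j k))

≤⇒≡+∣-∣ : ∀ {i j} → i ℤ.≤ j → j ≡ i ℤ.+ + ℤ.∣ j ℤ.- i ∣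
≤⇒≡+∣-∣ {i} {j} i≤j = trans (sym (cancel i j)) (cong (ℤ._+_ i) (sym (ℤₚ.0≤i⇒+∣i∣≡i (ℤₚ.i≤j⇒0≤j-i i≤j))))
  where
  cancel : ∀ i j → i ℤ.+ (j ℤ.- i) ≡ j
  cancel = solve-∀

range-intsFrom : ∀ lo k → range lo (lo ℤ.+ + k) ≡ intsFrom lo (suc k)
range-intsFrom lo k rewrite ⌊⌋-true (lo ℤ.≤? lo ℤ.+ + k) (ℤₚ.i≤i+j lo (+ k)) =
  cong (intsFrom lo ∘ ℤ.∣_∣) (length-eq lo (+ k))
  where
  length-eq : ∀ lo k → (lo ℤ.+ k ℤ.+ 1ℤ) ℤ.- lo ≡ 1ℤ ℤ.+ k
  length-eq = solve-∀

range-empty : ∀ {lo hi} → hi ℤ.< lo → range lo hi ≡ []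
range-empty {lo} {hi} hi<lo rewrite ⌊⌋-false (lo ℤ.≤? hi) (ℤₚ.<⇒≱ hi<lo) = refl

intsFrom-snoc : ∀ lo k → intsFrom lo (suc k) ≡ intsFrom lo k ++ [ lo ℤ.+ + k ]
intsFrom-snoc lo zero    = cong [_] (sym (ℤₚ.+-identityʳ lo))
intsFrom-snoc lo (suc k) = cong (lo ∷_) (trans (intsFrom-snoc (lo ℤ.+ 1ℤ) k)
  (cong (λ i → intsFrom (lo ℤ.+ 1ℤ) k ++ [ i ]) (i+1+j≡i+[1+j] lo (+ k))))

range-cons : ∀ {lo hi} → lo ℤ.≤ hi → range lo hi ≡ lo ∷ range (lo ℤ.+ 1ℤ) hi
range-cons {lo} lo≤hi =
  subst (λ hi → range lo hi ≡ lo ∷ range (lo ℤ.+ 1ℤ) hi) (sym (≤⇒≡+∣-∣ lo≤hi)) (cons _)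
  where
  cons : ∀ k → range lo (lo ℤ.+ + k) ≡ lo ∷ range (lo ℤ.+ 1ℤ) (lo ℤ.+ + k)
  cons zero    rewrite range-intsFrom lo 0 = cong (lo ∷_) (sym (range-empty (ℤₚ.+-monoʳ-< lo (ℤ.+<+ ℕₚ.0<1+n))))
  cons (suc k) rewrite range-intsFrom lo (suc k) | sym (i+1+j≡i+[1+j] lo (+ k)) =
    cong (lo ∷_) (sym (range-intsFrom (lo ℤ.+ 1ℤ) k))

range-snoc : ∀ {lo hi} → lo ℤ.≤ hi → range lo hi ≡ range lo (hi ℤ.- 1ℤ) ++ [ hi ]
range-snoc {lo} lo≤hi =
  subst (λ hi → range lo hi ≡ range lo (hi ℤ.- 1ℤ) ++ [ hi ]) (sym (≤⇒≡+∣-∣ lo≤hi)) (snoc _)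
  where
  unshift : ∀ lo k → lo ℤ.+ (1ℤ ℤ.+ k) ℤ.- 1ℤ ≡ lo ℤ.+ k
  unshift = solve-∀
  pred-eq : ∀ lo → lo ℤ.+ 0ℤ ℤ.- 1ℤ ≡ ℤ.-1ℤ ℤ.+ lo
  pred-eq = solve-∀
  init : ∀ k → range lo (lo ℤ.+ + k ℤ.- 1ℤ) ≡ intsFrom lo k
  init zero    = range-empty (ℤₚ.i≤pred[j]⇒i<j (ℤₚ.≤-reflexive (pred-eq lo)))
  init (suc k) rewrite unshift lo (+ k) = range-intsFrom lo k
  snoc : ∀ k → range lo (lo ℤ.+ + k) ≡ range lo (lo ℤ.+ + k ℤ.- 1ℤ) ++ [ lo ℤ.+ + k ]
  snoc k rewrite range-intsFrom lo k | init k = intsFrom-snoc lo k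

module PathGeometry (p : ℕ) where
  open Paths p

  endH-∷ʳ : ∀ h γ s → endH h (γ ∷ʳ s) ≡ next (endH h γ) s
  endH-∷ʳ h []      s = refl
  endH-∷ʳ h (t ∷ γ) s = endH-∷ʳ (next h t) γ s

  pathMin-∷ʳ : ∀ h γ s → pathMin h (γ ∷ʳ s) ≡ pathMin h γ ⊓ next (endH h γ) s
  pathMin-∷ʳ h []      s = refl
  pathMin-∷ʳ h (t ∷ γ) s =
    trans (cong (h ⊓_) (pathMin-∷ʳ (next h t) γ s)) (sym (ℤₚ.⊓-assoc h _ _))

  pathMin≤start : ∀ h γ → pathMin h γ ℤ.≤ h
  pathMin≤start h []      = ℤₚ.≤-refl
  pathMin≤start h (s ∷ γ) = ℤₚ.i⊓j≤i h _

  pathMin≤endH : ∀ h γ → pathMin h γ ℤ.≤ endH h γ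
  pathMin≤endH h []      = ℤₚ.≤-refl
  pathMin≤endH h (s ∷ γ) = ℤₚ.≤-trans (ℤₚ.i⊓j≤j h _) (pathMin≤endH (next h s) γ)

  start≤pathMax : ∀ h γ → h ℤ.≤ pathMax h γ
  start≤pathMax h []      = ℤₚ.≤-refl
  start≤pathMax h (s ∷ γ) = ℤₚ.i≤i⊔j h _

  endH≤pathMax : ∀ h γ → endH h γ ℤ.≤ pathMax h γ
  endH≤pathMax h []      = ℤₚ.≤-refl
  endH≤pathMax h (s ∷ γ) = ℤₚ.≤-trans (endH≤pathMax (next h s) γ) (ℤₚ.i≤j⊔i h _)

  endH≤start+length : ∀ h γ → endH h γ ℤ.≤ h ℤ.+ + length γ
  endH≤start+length h []       = ℤₚ.i≤i+j h (+ 0)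
  endH≤start+length h (true ∷ γ) =
    subst (endH (h ℤ.+ 1ℤ) γ ℤ.≤_) (i+1+j≡i+[1+j] h (+ length γ)) (endH≤start+length (h ℤ.+ 1ℤ) γ)
  endH≤start+length h (false ∷ γ) = ℤₚ.≤-trans (endH≤start+length (h ℤ.- + p) γ)
    (subst (ℤ._≤ h ℤ.+ + suc (length γ)) (sym (shift h (+ p) (+ length γ)))
           (ℤₚ.i-j≤i (h ℤ.+ + suc (length γ)) (+ suc p)))
    where
    shift : ∀ h p n → (h ℤ.- p) ℤ.+ n ≡ h ℤ.+ (1ℤ ℤ.+ n) ℤ.- (1ℤ ℤ.+ p)
    shift = solve-∀

  start≤endH+length*p : ∀ h γ → h ℤ.≤ endH h γ ℤ.+ + (length γ * p)
  start≤endH+length*p h []          = ℤₚ.i≤i+j h (+ 0)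
  start≤endH+length*p h (true ∷ γ)  = begin
    h                                        ≤⟨ ℤₚ.i≤i+j h 1ℤ ⟩
    h ℤ.+ 1ℤ                                 ≤⟨ start≤endH+length*p (h ℤ.+ 1ℤ) γ ⟩
    endH (h ℤ.+ 1ℤ) γ ℤ.+ + (length γ * p)   ≤⟨ ℤₚ.+-monoʳ-≤ (endH (h ℤ.+ 1ℤ) γ) (ℤ.+≤+ (ℕₚ.m≤n+m (length γ * p) p)) ⟩
    endH (h ℤ.+ 1ℤ) γ ℤ.+ + (p + length γ * p) ∎
    where open ℤₚ.≤-Reasoning
  start≤endH+length*p h (false ∷ γ) = begin
    h                                              ≡⟨ unshift h (+ p) ⟩
    (h ℤ.- + p) ℤ.+ + p                            ≤⟨ ℤₚ.+-monoˡ-≤ (+ p) (start≤endH+length*p (h ℤ.- + p) γ) ⟩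
    endH (h ℤ.- + p) γ ℤ.+ + (length γ * p) ℤ.+ + p ≡⟨ shift (endH (h ℤ.- + p) γ) (+ p) (+ (length γ * p)) ⟩
    endH (h ℤ.- + p) γ ℤ.+ (+ p ℤ.+ + (length γ * p))
      ≡⟨ cong (ℤ._+_ (endH (h ℤ.- + p) γ)) (sym (ℤₚ.pos-+ p (length γ * p))) ⟩
    endH (h ℤ.- + p) γ ℤ.+ + (p + length γ * p)    ∎
    where
    open ℤₚ.≤-Reasoning
    unshift : ∀ h p → h ≡ (h ℤ.- p) ℤ.+ p
    unshift = solve-∀
    shift : ∀ e p x → e ℤ.+ x ℤ.+ p ≡ e ℤ.+ (p ℤ.+ x)
    shift = solve-∀

  endH-unreachable-above : ∀ {h t} γ → h ℤ.+ + length γ ℤ.< t → endH h γ ≢ t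
  endH-unreachable-above {h} γ lt = ℤₚ.<⇒≢ (ℤₚ.≤-<-trans (endH≤start+length h γ) lt)

  endH-unreachable-below : ∀ {h t} γ → t ℤ.+ + (length γ * p) ℤ.< h → endH h γ ≢ t
  endH-unreachable-below {h} {t} γ lt refl =
    ℤₚ.<⇒≱ lt (start≤endH+length*p h γ)

-- Weighted sums over paths

module PathSums {c ℓ : Level} (R : CommutativeRing c ℓ) (p : ℕ) (a : ℤ → CommutativeRing.Carrier R) where
  open CommutativeRing R hiding (zero)
    renaming (_+_ to _⊕_; _*_ to _⊗_; refl to ≈-refl; sym to ≈-sym; trans to ≈-trans)
  open Weights R p a
  open PathGeometry p

  sumL-++ : ∀ {A : Set} (f : A → Carrier) xs ys → sumL f (xs ++ ys) ≈ sumL f xs ⊕ sumL f ys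
  sumL-++ f []       ys = ≈-sym (+-identityˡ _)
  sumL-++ f (x ∷ xs) ys = ≈-trans (+-congˡ (sumL-++ f xs ys)) (≈-sym (+-assoc _ _ _))

  sumL-map : ∀ {A B : Set} (f : B → Carrier) (g : A → B) xs → sumL f (map g xs) ≡ sumL (f ∘ g) xs
  sumL-map f g []       = refl
  sumL-map f g (x ∷ xs) = cong (f (g x) ⊕_) (sumL-map f g xs)

  sumL-0# : ∀ {A : Set} (xs : List A) → sumL (λ _ → 0#) xs ≈ 0#
  sumL-0# []       = ≈-refl
  sumL-0# (x ∷ xs) = ≈-trans (+-identityˡ _) (sumL-0# xs)

  sumL-*ˡ : ∀ {A : Set} x (f : A → Carrier) xs → sumL (λ y → x ⊗ f y) xs ≈ x ⊗ sumL f xs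
  sumL-*ˡ x f []       = ≈-sym (zeroʳ x)
  sumL-*ˡ x f (y ∷ ys) = ≈-trans (+-congˡ (sumL-*ˡ x f ys)) (≈-sym (distribˡ x _ _))

  sumL-*ʳ : ∀ {A : Set} x (f : A → Carrier) xs → sumL (λ y → f y ⊗ x) xs ≈ sumL f xs ⊗ x
  sumL-*ʳ x f []       = ≈-sym (zeroˡ x)
  sumL-*ʳ x f (y ∷ ys) = ≈-trans (+-congˡ (sumL-*ʳ x f ys)) (≈-sym (distribʳ x _ _))

  sumL-allSeqs-∷ : ∀ n (f : List Step → Carrier) →
    sumL f (allSeqs (suc n)) ≈ sumL (f ∘ (true ∷_)) (allSeqs n) ⊕ sumL (f ∘ (false ∷_)) (allSeqs n)
  sumL-allSeqs-∷ n f = ≈-trans (sumL-++ f (map (true ∷_) (allSeqs n)) (map (false ∷_) (allSeqs n)))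
    (+-cong (reflexive (sumL-map f _ (allSeqs n))) (reflexive (sumL-map f _ (allSeqs n))))

  sumL-allSeqs-cong : ∀ n {f g : List Step → Carrier} →
    (∀ γ → length γ ≡ n → f γ ≈ g γ) → sumL f (allSeqs n) ≈ sumL g (allSeqs n)
  sumL-allSeqs-cong zero    f≈g = +-congʳ (f≈g [] refl)
  sumL-allSeqs-cong (suc n) {f} {g} f≈g = begin
    sumL f (allSeqs (suc n))
      ≈⟨ sumL-allSeqs-∷ n f ⟩
    sumL (f ∘ (true ∷_)) (allSeqs n) ⊕ sumL (f ∘ (false ∷_)) (allSeqs n)
      ≈⟨ +-cong (sumL-allSeqs-cong n (λ γ l → f≈g (true ∷ γ) (cong suc l)))
                (sumL-allSeqs-cong n (λ γ l → f≈g (false ∷ γ) (cong suc l))) ⟩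
    sumL (g ∘ (true ∷_)) (allSeqs n) ⊕ sumL (g ∘ (false ∷_)) (allSeqs n)
      ≈⟨ sumL-allSeqs-∷ n g ⟨
    sumL g (allSeqs (suc n)) ∎
    where open ≈-Reasoning setoid

  sumL-allSeqs-∷ʳ : ∀ n (f : List Step → Carrier) →
    sumL f (allSeqs (suc n)) ≈ sumL (λ γ → f (γ ∷ʳ true)) (allSeqs n) ⊕ sumL (λ γ → f (γ ∷ʳ false)) (allSeqs n)
  sumL-allSeqs-∷ʳ zero    f = +-congʳ (≈-sym (+-identityʳ _))
  sumL-allSeqs-∷ʳ (suc n) f = begin
    sumL f (allSeqs (suc (suc n)))
      ≈⟨ sumL-allSeqs-∷ (suc n) f ⟩
    sumL (f ∘ (true ∷_)) (allSeqs (suc n)) ⊕ sumL (f ∘ (false ∷_)) (allSeqs (suc n))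
      ≈⟨ +-cong (sumL-allSeqs-∷ʳ n (f ∘ (true ∷_))) (sumL-allSeqs-∷ʳ n (f ∘ (false ∷_))) ⟩
    (sumL (λ γ → f (true ∷ γ ∷ʳ true)) (allSeqs n) ⊕ sumL (λ γ → f (true ∷ γ ∷ʳ false)) (allSeqs n)) ⊕
    (sumL (λ γ → f (false ∷ γ ∷ʳ true)) (allSeqs n) ⊕ sumL (λ γ → f (false ∷ γ ∷ʳ false)) (allSeqs n))
      ≈⟨ interchange _ _ _ _ ⟩
    (sumL (λ γ → f (true ∷ γ ∷ʳ true)) (allSeqs n) ⊕ sumL (λ γ → f (false ∷ γ ∷ʳ true)) (allSeqs n)) ⊕
    (sumL (λ γ → f (true ∷ γ ∷ʳ false)) (allSeqs n) ⊕ sumL (λ γ → f (false ∷ γ ∷ʳ false)) (allSeqs n))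
      ≈⟨ +-cong (sumL-allSeqs-∷ n (λ γ → f (γ ∷ʳ true))) (sumL-allSeqs-∷ n (λ γ → f (γ ∷ʳ false))) ⟨
    sumL (λ γ → f (γ ∷ʳ true)) (allSeqs (suc n)) ⊕ sumL (λ γ → f (γ ∷ʳ false)) (allSeqs (suc n)) ∎
    where
    open ≈-Reasoning setoid
    open CommutativeSemigroupProperties +-commutativeSemigroup using (interchange)

  weight-∷ʳ-true : ∀ h γ → weight h (γ ∷ʳ true) ≈ weight h γ
  weight-∷ʳ-true h []          = ≈-refl
  weight-∷ʳ-true h (true ∷ γ)  = weight-∷ʳ-true (h ℤ.+ 1ℤ) γ
  weight-∷ʳ-true h (false ∷ γ) = *-congˡ (weight-∷ʳ-true (h ℤ.- + p) γ)

  weight-∷ʳ-false : ∀ h γ → weight h (γ ∷ʳ false) ≈ weight h γ ⊗ a (endH h γ ℤ.- + p)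
  weight-∷ʳ-false h []          = *-comm _ _
  weight-∷ʳ-false h (true ∷ γ)  = weight-∷ʳ-false (h ℤ.+ 1ℤ) γ
  weight-∷ʳ-false h (false ∷ γ) =
    ≈-trans (*-congˡ (weight-∷ʳ-false (h ℤ.- + p) γ)) (≈-sym (*-assoc _ _ _))

  sumPaths-cong : ∀ n h {P Q : List Step → Bool} →
    (∀ γ → length γ ≡ n → P γ ≡ Q γ) → sumPaths n h P ≈ sumPaths n h Q
  sumPaths-cong n h P≡Q =
    sumL-allSeqs-cong n (λ γ l → reflexive (cong (λ b → if b then weight h γ else 0#) (P≡Q γ l)))

  sumPaths-≡ : ∀ {n n'} h P → n ≡ n' → sumPaths n h P ≈ sumPaths n' h P
  sumPaths-≡ h P refl = ≈-refl

  sumPaths-zero : ∀ n h {P : List Step → Bool} →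
    (∀ γ → length γ ≡ n → P γ ≡ false) → sumPaths n h P ≈ 0#
  sumPaths-zero n h P≡false = ≈-trans (sumPaths-cong n h P≡false) (sumL-0# (allSeqs n))

  if-⊗ˡ : ∀ (b : Bool) x y → (if b then x ⊗ y else 0#) ≈ x ⊗ (if b then y else 0#)
  if-⊗ˡ true  x y = ≈-refl
  if-⊗ˡ false x y = ≈-sym (zeroʳ x)

  sumPaths-∷ : ∀ n h (P : ℤ → List Step → Bool) → (∀ s γ → P h (s ∷ γ) ≡ P (next h s) γ) →
    sumPaths (suc n) h (P h) ≈
      sumPaths n (h ℤ.+ 1ℤ) (P (h ℤ.+ 1ℤ)) ⊕ a (h ℤ.- + p) ⊗ sumPaths n (h ℤ.- + p) (P (h ℤ.- + p))
  sumPaths-∷ n h P P-shift = ≈-trans (sumL-allSeqs-∷ n _) (+-cong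
    (sumL-allSeqs-cong n (λ γ _ → reflexive (cong (λ b → if b then weight (h ℤ.+ 1ℤ) γ else 0#) (P-shift true γ))))
    (≈-trans (sumL-allSeqs-cong n (λ γ _ → ≈-trans
                (reflexive (cong (λ b → if b then a (h ℤ.- + p) ⊗ weight (h ℤ.- + p) γ else 0#) (P-shift false γ)))
                (if-⊗ˡ (P (h ℤ.- + p) γ) _ _)))
             (sumL-*ˡ _ _ (allSeqs n))))

  sumPaths-∷ʳ : ∀ n h t (P : List Step → Bool) → (∀ γ → P γ ≡ true → endH h γ ≡ t) →
    sumPaths (suc n) h P ≈ sumPaths n h (λ γ → P (γ ∷ʳ true)) ⊕ sumPaths n h (λ γ → P (γ ∷ʳ false)) ⊗ a t
  sumPaths-∷ʳ n h t P P⇒ends = ≈-trans (sumL-allSeqs-∷ʳ n _) (+-cong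
    (sumL-allSeqs-cong n (λ γ _ → up γ))
    (≈-trans (sumL-allSeqs-cong n (λ γ _ → down γ)) (sumL-*ʳ (a t) _ (allSeqs n))))
    where
    up : ∀ γ → (if P (γ ∷ʳ true) then weight h (γ ∷ʳ true) else 0#) ≈
               (if P (γ ∷ʳ true) then weight h γ else 0#)
    up γ with P (γ ∷ʳ true)
    ... | true  = weight-∷ʳ-true h γ
    ... | false = ≈-refl
    down : ∀ γ → (if P (γ ∷ʳ false) then weight h (γ ∷ʳ false) else 0#) ≈
                 (if P (γ ∷ʳ false) then weight h γ else 0#) ⊗ a t
    down γ with P (γ ∷ʳ false) in ends
    ... | true  = ≈-trans (weight-∷ʳ-false h γ)
                    (*-congˡ (reflexive (cong a (trans (sym (endH-∷ʳ h γ false)) (P⇒ends (γ ∷ʳ false) ends)))))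
    ... | false = ≈-sym (zeroˡ _)

  nestedR-∷ : ∀ j r h → h ℤ.- + p ℤ.≤ + (r * p + j) →
    nestedR j (suc r) h ≈ nestedR j (suc r) (h ℤ.+ 1ℤ) ⊕ a (h ℤ.- + p) ⊗ nestedR j r (h ℤ.- + p)
  nestedR-∷ j r h h-p≤bound rewrite range-cons h-p≤bound | i-j+1≡i+1-j h (+ p) = +-comm _ _

  nestedR-empty : ∀ j r h → + (r * p + j) ℤ.< h ℤ.- + p → nestedR j (suc r) h ≈ 0#
  nestedR-empty j r h bound<h-p rewrite range-empty bound<h-p = ≈-refl

  nestedT-∷ : ∀ r lo → lo ℤ.≤ ℤ.- + p →
    nestedT (suc r) lo ≈ nestedT (suc r) (lo ℤ.+ 1ℤ) ⊕ a lo ⊗ nestedT r (lo ℤ.- + p)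
  nestedT-∷ r lo lo≤-p rewrite range-cons lo≤-p = +-comm _ _

  nestedT-empty : ∀ r lo → ℤ.- + p ℤ.< lo → nestedT (suc r) lo ≈ 0#
  nestedT-empty r lo -p<lo rewrite range-empty -p<lo = ≈-refl

  nestedS-∷ʳ : ∀ r t → 0ℤ ℤ.≤ t →
    nestedS (suc r) t ≈ nestedS (suc r) (t ℤ.- 1ℤ) ⊕ nestedS r (t ℤ.+ + p) ⊗ a t
  nestedS-∷ʳ r t 0≤t rewrite range-snoc 0≤t =
    ≈-trans (sumL-++ _ (range 0ℤ (t ℤ.- 1ℤ)) [ t ]) (+-congˡ (≈-trans (+-identityʳ _) (*-comm _ _)))

  nestedS-empty : ∀ r t → t ℤ.< 0ℤ → nestedS (suc r) t ≈ 0#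
  nestedS-empty r t t<0 rewrite range-empty t<0 = ≈-refl

  -- R: paths from 0 to j

  Ends : ℤ → ℤ → List Step → Bool
  Ends t h γ = ⌊ endH h γ ℤ.≟ t ⌋

  i+u≡[1+r]p+j⇒i-p+u≡rp+j : ∀ j r u i → i ℤ.+ + u ≡ + (suc r * p + j) → i ℤ.- + p ℤ.+ + u ≡ + (r * p + j)
  i+u≡[1+r]p+j⇒i-p+u≡rp+j j r u i eq =
    i+j≡k+l⇒i-k+j≡l i (+ u) (+ p) _ (trans eq (cong +_ (ℕₚ.+-assoc p (r * p) j)))

  sumPaths-Ends-∷ : ∀ j r n h → h ℤ.- + p ℤ.≤ + (r * p + j) →
    sumPaths n (h ℤ.+ 1ℤ) (Ends (+ j) (h ℤ.+ 1ℤ)) ≈ nestedR j (suc r) (h ℤ.+ 1ℤ) →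
    sumPaths n (h ℤ.- + p) (Ends (+ j) (h ℤ.- + p)) ≈ nestedR j r (h ℤ.- + p) →
    sumPaths (suc n) h (Ends (+ j) h) ≈ nestedR j (suc r) h
  sumPaths-Ends-∷ j r n h h-p≤bound up≈ down≈ = begin
    sumPaths (suc n) h (Ends (+ j) h)
      ≈⟨ sumPaths-∷ n h (Ends (+ j)) (λ _ _ → refl) ⟩
    sumPaths n (h ℤ.+ 1ℤ) (Ends (+ j) (h ℤ.+ 1ℤ)) ⊕ a (h ℤ.- + p) ⊗ sumPaths n (h ℤ.- + p) (Ends (+ j) (h ℤ.- + p))
      ≈⟨ +-cong up≈ (*-congˡ down≈) ⟩
    nestedR j (suc r) (h ℤ.+ 1ℤ) ⊕ a (h ℤ.- + p) ⊗ nestedR j r (h ℤ.- + p)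
      ≈⟨ nestedR-∷ j r h h-p≤bound ⟨
    nestedR j (suc r) h ∎
    where open ≈-Reasoning setoid

  -- A path of length r + u from h to j has r downsteps and u upsteps.
  sumPaths-Ends≈nestedR : ∀ j r u h → h ℤ.+ + u ≡ + (r * p + j) →
    sumPaths (r + u) h (Ends (+ j) h) ≈ nestedR j r h
  sumPaths-Ends≈nestedR j zero zero h h+0≡j =
    ≈-trans (+-identityʳ _) (reflexive (cong (λ b → if b then 1# else 0#)
      (⌊⌋-true (h ℤ.≟ + j) (trans (sym (ℤₚ.+-identityʳ h)) h+0≡j))))
  sumPaths-Ends≈nestedR j zero (suc u) h h+1+u≡j = begin
    sumPaths (suc u) h (Ends (+ j) h)
      ≈⟨ sumPaths-∷ u h (Ends (+ j)) (λ _ _ → refl) ⟩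
    sumPaths u (h ℤ.+ 1ℤ) (Ends (+ j) (h ℤ.+ 1ℤ)) ⊕ a (h ℤ.- + p) ⊗ sumPaths u (h ℤ.- + p) (Ends (+ j) (h ℤ.- + p))
      ≈⟨ +-cong (sumPaths-Ends≈nestedR j zero u (h ℤ.+ 1ℤ) (trans (i+1+j≡i+[1+j] h (+ u)) h+1+u≡j))
                (*-congˡ (sumPaths-zero u (h ℤ.- + p) unreachable)) ⟩
    1# ⊕ a (h ℤ.- + p) ⊗ 0#
      ≈⟨ ≈-trans (+-congˡ (zeroʳ _)) (+-identityʳ 1#) ⟩
    1# ∎
    where
    open ≈-Reasoning setoid
    unreachable : ∀ γ → length γ ≡ u → Ends (+ j) (h ℤ.- + p) γ ≡ false
    unreachable γ l = ⌊⌋-false _ (endH-unreachable-above γ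
      (subst (λ n → h ℤ.- + p ℤ.+ + n ℤ.< + j) (sym l)
             (subst (h ℤ.- + p ℤ.+ + u ℤ.<_) h+1+u≡j (i-k+j<i+[1+j] h p u))))
  sumPaths-Ends≈nestedR j (suc r) zero h h+0≡bound =
    sumPaths-Ends-∷ j r (r + 0) h (ℤₚ.≤-reflexive (trans (sym (ℤₚ.+-identityʳ _)) h-p+0≡bound))
      (≈-trans (sumPaths-zero (r + 0) (h ℤ.+ 1ℤ) unreachable) (≈-sym (nestedR-empty j r (h ℤ.+ 1ℤ) bound<h+1-p)))
      (sumPaths-Ends≈nestedR j r zero (h ℤ.- + p) h-p+0≡bound)
    where
    h-p+0≡bound = i+u≡[1+r]p+j⇒i-p+u≡rp+j j r 0 h h+0≡bound
    i-j+0+1≡i+1-j : ∀ i j → i ℤ.- j ℤ.+ 0ℤ ℤ.+ 1ℤ ≡ i ℤ.+ 1ℤ ℤ.- j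
    i-j+0+1≡i+1-j = solve-∀
    bound<h+1-p : + (r * p + j) ℤ.< h ℤ.+ 1ℤ ℤ.- + p
    bound<h+1-p = subst₂ ℤ._<_ h-p+0≡bound (i-j+0+1≡i+1-j h (+ p)) (i<i+[1+n] (h ℤ.- + p ℤ.+ 0ℤ) 0)
    j+rp<h+1 : + j ℤ.+ + (r * p) ℤ.< h ℤ.+ 1ℤ
    j+rp<h+1 = ℤₚ.≤-<-trans
      (ℤ.+≤+ (ℕₚ.≤-trans (ℕₚ.≤-reflexive (ℕₚ.+-comm j (r * p))) (ℕₚ.+-monoˡ-≤ j (ℕₚ.m≤n+m (r * p) p))))
      (subst (ℤ._< h ℤ.+ 1ℤ) h+0≡bound (ℤₚ.+-monoʳ-< h (ℤ.+<+ ℕₚ.0<1+n)))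
    unreachable : ∀ γ → length γ ≡ r + 0 → Ends (+ j) (h ℤ.+ 1ℤ) γ ≡ false
    unreachable γ l = ⌊⌋-false _ (endH-unreachable-below γ
      (subst (λ n → + j ℤ.+ + (n * p) ℤ.< h ℤ.+ 1ℤ) (sym (trans l (ℕₚ.+-identityʳ r))) j+rp<h+1))
  sumPaths-Ends≈nestedR j (suc r) (suc u) h h+1+u≡bound =
    sumPaths-Ends-∷ j r (r + suc u) h (subst (h ℤ.- + p ℤ.≤_) h-p+1+u≡bound (ℤₚ.i≤i+j (h ℤ.- + p) (+ suc u)))
      (≈-trans (sumPaths-≡ (h ℤ.+ 1ℤ) (Ends (+ j) (h ℤ.+ 1ℤ)) (ℕₚ.+-suc r u))
               (sumPaths-Ends≈nestedR j (suc r) u (h ℤ.+ 1ℤ) (trans (i+1+j≡i+[1+j] h (+ u)) h+1+u≡bound)))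
      (sumPaths-Ends≈nestedR j r (suc u) (h ℤ.- + p) h-p+1+u≡bound)
    where
    h-p+1+u≡bound = i+u≡[1+r]p+j⇒i-p+u≡rp+j j r (suc u) h h+1+u≡bound

  -- T: paths from -j to 0 with maximum 0

  MaxZero : ℤ → List Step → Bool
  MaxZero h γ = ⌊ endH h γ ℤ.≟ 0ℤ ×-dec pathMax h γ ℤ.≤? 0ℤ ⌋

  MaxZero-∷ : ∀ {h} → h ℤ.≤ 0ℤ → ∀ s γ → MaxZero h (s ∷ γ) ≡ MaxZero (next h s) γ
  MaxZero-∷ {h} h≤0 s γ = ⌊⌋-cong _ _
    (map₂ (ℤₚ.≤-trans (ℤₚ.i≤j⊔i h (pathMax (next h s) γ))))
    (map₂ (ℤₚ.⊔-lub h≤0))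

  sumPaths-MaxZero-∷ : ∀ r n h → h ℤ.≤ 0ℤ →
    sumPaths n (h ℤ.+ 1ℤ) (MaxZero (h ℤ.+ 1ℤ)) ≈ nestedT (suc r) (h ℤ.- + p ℤ.+ 1ℤ) →
    sumPaths n (h ℤ.- + p) (MaxZero (h ℤ.- + p)) ≈ nestedT r (h ℤ.- + p ℤ.- + p) →
    sumPaths (suc n) h (MaxZero h) ≈ nestedT (suc r) (h ℤ.- + p)
  sumPaths-MaxZero-∷ r n h h≤0 up≈ down≈ = begin
    sumPaths (suc n) h (MaxZero h)
      ≈⟨ sumPaths-∷ n h MaxZero (MaxZero-∷ h≤0) ⟩
    sumPaths n (h ℤ.+ 1ℤ) (MaxZero (h ℤ.+ 1ℤ)) ⊕ a (h ℤ.- + p) ⊗ sumPaths n (h ℤ.- + p) (MaxZero (h ℤ.- + p))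
      ≈⟨ +-cong up≈ (*-congˡ down≈) ⟩
    nestedT (suc r) (h ℤ.- + p ℤ.+ 1ℤ) ⊕ a (h ℤ.- + p) ⊗ nestedT r (h ℤ.- + p ℤ.- + p)
      ≈⟨ nestedT-∷ r (h ℤ.- + p) (subst (h ℤ.- + p ℤ.≤_) (ℤₚ.+-identityˡ (ℤ.- + p)) (ℤₚ.+-monoˡ-≤ (ℤ.- + p) h≤0)) ⟨
    nestedT (suc r) (h ℤ.- + p) ∎
    where open ≈-Reasoning setoid

  p+r[1+p]+u≡r[1+p]+[u+p] : ∀ r u → p + r * suc p + u ≡ r * suc p + (u + p)
  p+r[1+p]+u≡r[1+p]+[u+p] r u = identity r p u
    where
    identity : ∀ r p u → p + r * (1 + p) + u ≡ r * (1 + p) + (u + p)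
    identity = ℕ-solve-∀

  sumPaths-MaxZero≈nestedT : ∀ r u h → h ℤ.+ + u ≡ 0ℤ →
    sumPaths (r * suc p + u) h (MaxZero h) ≈ nestedT r (h ℤ.- + p)
  sumPaths-MaxZero≈nestedT zero zero h h+0≡0 =
    ≈-trans (+-identityʳ _) (reflexive (cong (λ b → if b then 1# else 0#)
      (⌊⌋-true (h ℤ.≟ 0ℤ ×-dec h ℤ.≤? 0ℤ) (h≡0 , ℤₚ.≤-reflexive h≡0))))
    where
    h≡0 = trans (sym (ℤₚ.+-identityʳ h)) h+0≡0
  sumPaths-MaxZero≈nestedT zero (suc u) h h+1+u≡0 = begin
    sumPaths (suc u) h (MaxZero h)
      ≈⟨ sumPaths-∷ u h MaxZero (MaxZero-∷ (subst (h ℤ.≤_) h+1+u≡0 (ℤₚ.i≤i+j h (+ suc u)))) ⟩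
    sumPaths u (h ℤ.+ 1ℤ) (MaxZero (h ℤ.+ 1ℤ)) ⊕ a (h ℤ.- + p) ⊗ sumPaths u (h ℤ.- + p) (MaxZero (h ℤ.- + p))
      ≈⟨ +-cong (sumPaths-MaxZero≈nestedT zero u (h ℤ.+ 1ℤ) (trans (i+1+j≡i+[1+j] h (+ u)) h+1+u≡0))
                (*-congˡ (sumPaths-zero u (h ℤ.- + p) unreachable)) ⟩
    1# ⊕ a (h ℤ.- + p) ⊗ 0#
      ≈⟨ ≈-trans (+-congˡ (zeroʳ _)) (+-identityʳ 1#) ⟩
    1# ∎
    where
    open ≈-Reasoning setoid
    unreachable : ∀ γ → length γ ≡ u → MaxZero (h ℤ.- + p) γ ≡ false
    unreachable γ l = ⌊⌋-false _ (endH-unreachable-above γ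
      (subst (λ n → h ℤ.- + p ℤ.+ + n ℤ.< 0ℤ) (sym l)
             (subst (h ℤ.- + p ℤ.+ + u ℤ.<_) h+1+u≡0 (i-k+j<i+[1+j] h p u)))
      ∘ proj₁)
  sumPaths-MaxZero≈nestedT (suc r) zero h h+0≡0 =
    sumPaths-MaxZero-∷ r (p + r * suc p + 0) h (ℤₚ.≤-reflexive h≡0)
      (≈-trans (sumPaths-zero (p + r * suc p + 0) (h ℤ.+ 1ℤ) (λ γ _ → ⌊⌋-false _ (too-high γ ∘ proj₂)))
               (≈-sym (nestedT-empty r (h ℤ.- + p ℤ.+ 1ℤ) -p<h-p+1)))
      (≈-trans (sumPaths-≡ (h ℤ.- + p) (MaxZero (h ℤ.- + p)) (p+r[1+p]+u≡r[1+p]+[u+p] r 0))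
               (sumPaths-MaxZero≈nestedT r p (h ℤ.- + p) (trans (i-k+[j+k]≡i+j h (+ p) 0ℤ) h+0≡0)))
    where
    h≡0 = trans (sym (ℤₚ.+-identityʳ h)) h+0≡0
    -p<h-p+1 : ℤ.- + p ℤ.< h ℤ.- + p ℤ.+ 1ℤ
    -p<h-p+1 = subst (ℤ._< h ℤ.- + p ℤ.+ 1ℤ) (trans (cong (ℤ._- + p) h≡0) (ℤₚ.+-identityˡ (ℤ.- + p)))
                     (i<i+[1+n] (h ℤ.- + p) 0)
    too-high : ∀ γ → ¬ (pathMax (h ℤ.+ 1ℤ) γ ℤ.≤ 0ℤ)
    too-high γ max≤0 = ℤₚ.<⇒≱ (ℤ.+<+ ℕₚ.0<1+n)
      (subst (λ h → h ℤ.+ 1ℤ ℤ.≤ 0ℤ) h≡0 (ℤₚ.≤-trans (start≤pathMax (h ℤ.+ 1ℤ) γ) max≤0))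
  sumPaths-MaxZero≈nestedT (suc r) (suc u) h h+1+u≡0 =
    sumPaths-MaxZero-∷ r (p + r * suc p + suc u) h (subst (h ℤ.≤_) h+1+u≡0 (ℤₚ.i≤i+j h (+ suc u)))
      (≈-trans (sumPaths-≡ (h ℤ.+ 1ℤ) (MaxZero (h ℤ.+ 1ℤ)) (ℕₚ.+-suc (p + r * suc p) u))
      (≈-trans (sumPaths-MaxZero≈nestedT (suc r) u (h ℤ.+ 1ℤ) (trans (i+1+j≡i+[1+j] h (+ u)) h+1+u≡0))
               (reflexive (cong (nestedT (suc r)) (sym (i-j+1≡i+1-j h (+ p)))))))
      (≈-trans (sumPaths-≡ (h ℤ.- + p) (MaxZero (h ℤ.- + p)) (p+r[1+p]+u≡r[1+p]+[u+p] r (suc u)))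
               (sumPaths-MaxZero≈nestedT r (suc u + p) (h ℤ.- + p)
                  (trans (i-k+[j+k]≡i+j h (+ p) (+ suc u)) h+1+u≡0)))

  -- S: paths from 0 to t with minimum 0

  MinZero : ℤ → List Step → Bool
  MinZero t γ = ⌊ endH 0ℤ γ ℤ.≟ t ×-dec 0ℤ ℤ.≤? pathMin 0ℤ γ ⌋

  MinZero⇒endH : ∀ t γ → MinZero t γ ≡ true → endH 0ℤ γ ≡ t
  MinZero⇒endH t γ = proj₁ ∘ ⌊⌋-true⁻¹ (endH 0ℤ γ ℤ.≟ t ×-dec 0ℤ ℤ.≤? pathMin 0ℤ γ)

  -- Stated at 1 + t so that it applies to t = + k and to t = -1 without rewriting.
  MinZero-∷ʳ-true : ∀ t γ → MinZero (1ℤ ℤ.+ t) (γ ∷ʳ true) ≡ MinZero t γ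
  MinZero-∷ʳ-true t γ rewrite endH-∷ʳ 0ℤ γ true | pathMin-∷ʳ 0ℤ γ true = ⌊⌋-cong _ _
    (λ (E+1≡1+t , 0≤min) → +-cancelʳ-≡ 1ℤ (trans E+1≡1+t (ℤₚ.+-comm 1ℤ t)) , ℤₚ.≤-trans 0≤min (ℤₚ.i⊓j≤i _ _))
    (λ (E≡t , 0≤min) → trans (cong (ℤ._+ 1ℤ) E≡t) (ℤₚ.+-comm t 1ℤ) ,
       ℤₚ.⊓-glb 0≤min (ℤₚ.≤-trans 0≤min (ℤₚ.≤-trans (pathMin≤endH 0ℤ γ) (ℤₚ.i≤i+j _ 1ℤ))))

  MinZero-∷ʳ-false : ∀ {t} → 0ℤ ℤ.≤ t → ∀ γ → MinZero t (γ ∷ʳ false) ≡ MinZero (t ℤ.+ + p) γ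
  MinZero-∷ʳ-false {t} 0≤t γ rewrite endH-∷ʳ 0ℤ γ false | pathMin-∷ʳ 0ℤ γ false = ⌊⌋-cong _ _
    (λ (E-p≡t , 0≤min) → +-cancelʳ-≡ (ℤ.- + p) (trans E-p≡t (sym (i+j-j≡i t (+ p)))) , ℤₚ.≤-trans 0≤min (ℤₚ.i⊓j≤i _ _))
    (λ (E≡t+p , 0≤min) → let E-p≡t = trans (cong (ℤ._- + p) E≡t+p) (i+j-j≡i t (+ p)) in
       E-p≡t , ℤₚ.⊓-glb 0≤min (subst (0ℤ ℤ.≤_) (sym E-p≡t) 0≤t))

  MinZero-negative : ∀ γ → MinZero ℤ.-1ℤ γ ≡ false
  MinZero-negative γ = ⌊⌋-false _ (λ (E≡-1 , 0≤min) →
    ℤₚ.<⇒≱ ℤ.-<+ (ℤₚ.≤-trans 0≤min (subst (pathMin 0ℤ γ ℤ.≤_) E≡-1 (pathMin≤endH 0ℤ γ))))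

  sumPaths-MinZero-∷ʳ : ∀ r n t → 0ℤ ℤ.≤ t →
    sumPaths n 0ℤ (λ γ → MinZero t (γ ∷ʳ true)) ≈ nestedS (suc r) (t ℤ.- 1ℤ) →
    sumPaths n 0ℤ (MinZero (t ℤ.+ + p)) ≈ nestedS r (t ℤ.+ + p) →
    sumPaths (suc n) 0ℤ (MinZero t) ≈ nestedS (suc r) t
  sumPaths-MinZero-∷ʳ r n t 0≤t up≈ down≈ = begin
    sumPaths (suc n) 0ℤ (MinZero t)
      ≈⟨ sumPaths-∷ʳ n 0ℤ t (MinZero t) (MinZero⇒endH t) ⟩
    sumPaths n 0ℤ (λ γ → MinZero t (γ ∷ʳ true)) ⊕ sumPaths n 0ℤ (λ γ → MinZero t (γ ∷ʳ false)) ⊗ a t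
      ≈⟨ +-cong up≈ (*-congʳ (≈-trans (sumPaths-cong n 0ℤ (λ γ _ → MinZero-∷ʳ-false 0≤t γ)) down≈)) ⟩
    nestedS (suc r) (t ℤ.- 1ℤ) ⊕ nestedS r (t ℤ.+ + p) ⊗ a t
      ≈⟨ nestedS-∷ʳ r t 0≤t ⟨
    nestedS (suc r) t ∎
    where open ≈-Reasoning setoid

  sumPaths-MinZero≈nestedS : ∀ r k → sumPaths (r * suc p + k) 0ℤ (MinZero (+ k)) ≈ nestedS r (+ k)
  sumPaths-MinZero≈nestedS zero zero = +-identityʳ 1#
  sumPaths-MinZero≈nestedS zero (suc k) = begin
    sumPaths (suc k) 0ℤ (MinZero (+ suc k))
      ≈⟨ sumPaths-∷ʳ k 0ℤ (+ suc k) (MinZero (+ suc k)) (MinZero⇒endH (+ suc k)) ⟩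
    sumPaths k 0ℤ (λ γ → MinZero (+ suc k) (γ ∷ʳ true)) ⊕
      sumPaths k 0ℤ (λ γ → MinZero (+ suc k) (γ ∷ʳ false)) ⊗ a (+ suc k)
      ≈⟨ +-cong (≈-trans (sumPaths-cong k 0ℤ (λ γ _ → MinZero-∷ʳ-true (+ k) γ)) (sumPaths-MinZero≈nestedS zero k))
                (*-congʳ (sumPaths-zero k 0ℤ unreachable)) ⟩
    1# ⊕ 0# ⊗ a (+ suc k)
      ≈⟨ ≈-trans (+-congˡ (zeroˡ _)) (+-identityʳ 1#) ⟩
    1# ∎
    where
    open ≈-Reasoning setoid
    unreachable : ∀ γ → length γ ≡ k → MinZero (+ suc k) (γ ∷ʳ false) ≡ false
    unreachable γ l = trans (MinZero-∷ʳ-false (ℤ.+≤+ ℕ.z≤n) γ) (⌊⌋-false _ (endH-unreachable-above γ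
      (ℤ.+<+ (ℕ.s≤s (ℕₚ.≤-trans (ℕₚ.≤-reflexive l) (ℕₚ.m≤m+n k p)))) ∘ proj₁))
  sumPaths-MinZero≈nestedS (suc r) zero =
    sumPaths-MinZero-∷ʳ r (p + r * suc p + 0) 0ℤ ℤₚ.≤-refl
      (≈-trans (sumPaths-zero (p + r * suc p + 0) 0ℤ (λ γ _ → trans (MinZero-∷ʳ-true ℤ.-1ℤ γ) (MinZero-negative γ)))
               (≈-sym (nestedS-empty r ℤ.-1ℤ ℤ.-<+)))
      (≈-trans (sumPaths-≡ 0ℤ (MinZero (+ p)) (p+r[1+p]+u≡r[1+p]+[u+p] r 0)) (sumPaths-MinZero≈nestedS r p))
  sumPaths-MinZero≈nestedS (suc r) (suc k) =
    sumPaths-MinZero-∷ʳ r (p + r * suc p + suc k) (+ suc k) (ℤ.+≤+ ℕ.z≤n)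
      (≈-trans (sumPaths-cong (p + r * suc p + suc k) 0ℤ (λ γ _ → MinZero-∷ʳ-true (+ k) γ))
        (≈-trans (sumPaths-≡ 0ℤ (MinZero (+ k)) (ℕₚ.+-suc (p + r * suc p) k))
                 (sumPaths-MinZero≈nestedS (suc r) k)))
      (≈-trans (sumPaths-≡ 0ℤ (MinZero (+ (suc k + p))) (p+r[1+p]+u≡r[1+p]+[u+p] r (suc k)))
               (sumPaths-MinZero≈nestedS r (suc k + p)))

  Spoly≈sumPaths-MinZero : ∀ n j → Spoly n j ≈ sumPaths n 0ℤ (MinZero (+ j))
  Spoly≈sumPaths-MinZero n j = sumPaths-cong n 0ℤ (λ γ _ →
    trans (⌊⌋-∧ (endH 0ℤ γ ℤ.≟ + j) (pathMin 0ℤ γ ℤ.≟ 0ℤ))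
          (⌊⌋-cong (endH 0ℤ γ ℤ.≟ + j ×-dec pathMin 0ℤ γ ℤ.≟ 0ℤ)
                   (endH 0ℤ γ ℤ.≟ + j ×-dec 0ℤ ℤ.≤? pathMin 0ℤ γ)
                   (map₂ (λ min≡0 → ℤₚ.≤-reflexive (sym min≡0)))
                   (map₂ (ℤₚ.≤-antisym (pathMin≤start 0ℤ γ)))))

  Tpoly≈sumPaths-MaxZero : ∀ n j → Tpoly n j ≈ sumPaths n (ℤ.- + j) (MaxZero (ℤ.- + j))
  Tpoly≈sumPaths-MaxZero n j = sumPaths-cong n (ℤ.- + j) (λ γ _ →
    trans (⌊⌋-∧ (endH (ℤ.- + j) γ ℤ.≟ 0ℤ) (pathMax (ℤ.- + j) γ ℤ.≟ 0ℤ))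
          (⌊⌋-cong (endH (ℤ.- + j) γ ℤ.≟ 0ℤ ×-dec pathMax (ℤ.- + j) γ ℤ.≟ 0ℤ)
                   (endH (ℤ.- + j) γ ℤ.≟ 0ℤ ×-dec pathMax (ℤ.- + j) γ ℤ.≤? 0ℤ)
                   (map₂ ℤₚ.≤-reflexive)
                   (λ (end≡0 , max≤0) → end≡0 , ℤₚ.≤-antisym max≤0
                      (subst (ℤ._≤ pathMax (ℤ.- + j) γ) end≡0 (endH≤pathMax (ℤ.- + j) γ)))))

theorem1p5 : {c ℓ : Level} (R : CommutativeRing c ℓ) (p : ℕ) → 1 ≤ p →
    (a : ℤ → CommutativeRing.Carrier R) (m j : ℕ) → j ≤ p →
    let open CommutativeRing R using (_≈_)
        open Weights R p a
    in (Rpoly (m * (p + 1) + j) j ≈ Rrhs m j)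
       × (Spoly (m * (p + 1) + j) j ≈ Srhs m j)
       × (Tpoly (m * (p + 1) + j) j ≈ Trhs m j)
theorem1p5 R p _ a m j _ =
    ≈-trans (sumPaths-≡ 0ℤ (Ends (+ j) 0ℤ) (length-R m p j))
            (sumPaths-Ends≈nestedR j m (m * p + j) 0ℤ refl)
  , ≈-trans (Spoly≈sumPaths-MinZero (m * (p + 1) + j) j)
      (≈-trans (sumPaths-≡ 0ℤ (MinZero (+ j)) (length-ST m p j)) (sumPaths-MinZero≈nestedS m j))
  , ≈-trans (Tpoly≈sumPaths-MaxZero (m * (p + 1) + j) j)
      (≈-trans (sumPaths-≡ (ℤ.- + j) (MaxZero (ℤ.- + j)) (length-ST m p j))
               (sumPaths-MaxZero≈nestedT m j (ℤ.- + j) (ℤₚ.+-inverseˡ (+ j))))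
  where
  open PathSums R p a
  open CommutativeRing R using () renaming (trans to ≈-trans)
  length-R : ∀ m p j → m * (p + 1) + j ≡ m + (m * p + j)
  length-R = ℕ-solve-∀
  length-ST : ∀ m p j → m * (p + 1) + j ≡ m * (1 + p) + j
  length-ST = ℕ-solve-∀
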